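{- Let $A$ be an HF formula which is a $\Sigma$ formula, which has no free variables, and which is true in the standard model of hereditarily finite sets. Then $\emptyset \vdash A$ in the HF calculus.
   Context: The HF calculus is the following first-order theory. Its language has a constant $0$, a binary function symbol $\lhd$, a binary relation symbol $\in$, and equality. The primitive connectives are $\vee$, $\neg$ and $\exists$; the others are abbreviations, including the bounded quantifier $\forall (i\in t)\,A$. $H \vdash A$ means that $A$ is derivable from hypotheses $H$. The derivations may use: - the propositional axioms, the equality axioms and the quantifier axioms; - the axioms $z=0 \leftrightarrow \forall x\,(x\notin z)$ and $z = x\lhd y \leftrightarrow \forall u\,(u\in z \leftrightarrow u\in x \vee u=y)$; - all instances of the induction schema $\phi(0)\wedge \forall x y\,(\phi(x)\wedge\phi(y)\to\phi(x\lhd y)) \to \forall x\,\phi(x)$; - one fixed additional axiom, which is a sentence true in the standard model; - modus ponens, where from $H\vdash A\to B$ and $H'\vdash A$ one infers $H\cup H'\vdash B$; - the existential rule, where from $H\vdash A\to B$ one infers $H\vdash (\exists i\,A)\to B$ when $i$ is not free in $B$ or in $H$. The standard model consists of the hereditarily finite sets, with $0=\emptyset$ and $x\lhd y=x\cup\{y\}$. Strict $\Sigma$ formulas are defined inductively. Every formula $x_i\in x_j$ with $x_i,x_j$ variables is strict $\Sigma$. If $A$ and $B$ are strict $\Sigma$, then so are $A\vee B$, $A\wedge B$ and $\exists x_i\,A$. Finally, $\forall(x_i\in x_j)\,A$ is strict $\Sigma$ when $A$ is strict $\Sigma$ and $x_j$ is distinct from $x_i$ and not free in $A$. A $\Sigma$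 formula is a formula $A$ for which there exists a strict $\Sigma$ formula $B$ satisfying two conditions: every free variable of $B$ is free in $A$, and $\emptyset\vdash A\leftrightarrow B$. -}

module Defs where

open import Data.Nat using (ℕ; zero; suc)
open import Data.List using (List; []; _∷_; map; _++_)
open import Data.List.Membership.Propositional using (_∈_)
open import Data.Product using (Σ; _×_; _,_)
open import Data.Sum using (_⊎_)
open import Data.Empty using (⊥)
open import Data.Unit using (⊤)
open import Relation.Nullary using (¬_)
open import Relation.Binary.PropositionalEquality using (_≡_)

-- Syntax of the HF calculus (de Bruijn indices: var 0 is the innermost
-- bound variable; free variables are the indices not captured).

infixr 8 _◁_
data Tm : Set where
  var : ℕ → Tm
  zer : Tm
  _◁_ : Tm → Tm → Tm

infix 7 _IN_ _EQ_
infixr 6 _OR_ _AND_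
infixr 5 _IMP_ _IFF_
data Fm : Set where
  _IN_ : Tm → Tm → Fm
  _EQ_ : Tm → Tm → Fm
  _OR_ : Fm → Fm → Fm
  NEG  : Fm → Fm
  EX   : Fm → Fm

_AND_ : Fm → Fm → Fm
A AND B = NEG (NEG A OR NEG B)

_IMP_ : Fm → Fm → Fm
A IMP B = NEG A OR B

_IFF_ : Fm → Fm → Fm
A IFF B = (A IMP B) AND (B IMP A)

ALL : Fm → Fm
ALL A = NEG (EX (NEG A))

extR : (ℕ → ℕ) → ℕ → ℕ
extR ρ zero    = zero
extR ρ (suc n) = suc (ρ n)

renT : (ℕ → ℕ) → Tm → Tm
renT ρ (var n) = var (ρ n)
renT ρ zer     = zer
renT ρ (t ◁ u) = renT ρ t ◁ renT ρ u

shiftT : Tm → Tm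
shiftT = renT suc

ren : (ℕ → ℕ) → Fm → Fm
ren ρ (t IN u)  = renT ρ t IN renT ρ u
ren ρ (t EQ u)  = renT ρ t EQ renT ρ u
ren ρ (A OR B)  = ren ρ A OR ren ρ B
ren ρ (NEG A)   = NEG (ren ρ A)
ren ρ (EX A)    = EX (ren (extR ρ) A)

shift : Fm → Fm
shift = ren suc

extS : (ℕ → Tm) → ℕ → Tm
extS σ zero    = var zero
extS σ (suc n) = shiftT (σ n)

subT : (ℕ → Tm) → Tm → Tm
subT σ (var n) = σ n
subT σ zer     = zer
subT σ (t ◁ u) = subT σ t ◁ subT σ u

sub : (ℕ → Tm) → Fm → Fm
sub σ (t IN u)  = subT σ t IN subT σ u
sub σ (t EQ u)  = subT σ t EQ subT σ u
sub σ (A OR B)  = sub σ A OR sub σ B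
sub σ (NEG A)   = NEG (sub σ A)
sub σ (EX A)    = EX (sub (extS σ) A)

-- A(t/x) where x is the bound variable 0 of the body A
sub0 : Tm → ℕ → Tm
sub0 t zero    = t
sub0 t (suc n) = var n

_[_] : Fm → Tm → Fm
A [ t ] = sub (sub0 t) A

-- bounded quantifier ∀(i ∈ t) A, i.e. ∀ i (i ∈ t → A); A binds var 0
ALL2 : Tm → Fm → Fm
ALL2 t A = ALL ((var zero IN shiftT t) IMP A)

FreeT : ℕ → Tm → Set
FreeT n (var m) = n ≡ m
FreeT n zer     = ⊥
FreeT n (t ◁ u) = FreeT n t ⊎ FreeT n u

Free : ℕ → Fm → Set
Free n (t IN u) = FreeT n t ⊎ FreeT n u
Free n (t EQ u) = FreeT n t ⊎ FreeT n u
Free n (A OR B) = Free n A ⊎ Free n B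
Free n (NEG A)  = Free n A
Free n (EX A)   = Free (suc n) A

Sentence : Fm → Set
Sentence A = ∀ n → ¬ Free n A

v0 v1 v2 v3 : Tm
v0 = var 0
v1 = var 1
v2 = var 2
v3 = var 3

data BoolAx : Fm → Set where
  ident     : ∀ A → BoolAx (A IMP A)
  disjI1    : ∀ A B → BoolAx (A IMP (A OR B))
  disjCont  : ∀ A → BoolAx ((A OR A) IMP A)
  disjAssoc : ∀ A B C → BoolAx ((A OR (B OR C)) IMP ((A OR B) OR C))
  disjConj  : ∀ A B C → BoolAx ((C OR A) IMP ((NEG C OR B) IMP (A OR B)))

data EqAx : Fm → Set where
  eqRefl : EqAx (v0 EQ v0)
  eqIn   : EqAx (((v0 EQ v1) AND (v2 EQ v3)) IMP ((v0 IN v2) IMP (v1 IN v3)))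
  eqEq   : EqAx (((v0 EQ v1) AND (v2 EQ v3)) IMP ((v0 EQ v2) IMP (v1 EQ v3)))
  eqEats : EqAx (((v0 EQ v1) AND (v2 EQ v3)) IMP ((v0 ◁ v2) EQ (v1 ◁ v3)))

data QuantAx : Fm → Set where
  exI : ∀ A t → QuantAx ((A [ t ]) IMP EX A)

-- HF axioms (z = var 0, x = var 1, y = var 2; under one binder these shift)
data HFAx : Fm → Set where
  hf1 : HFAx ((v0 EQ zer) IFF ALL (NEG (v0 IN v1)))
  hf2 : HFAx ((v0 EQ (v1 ◁ v2)) IFF
              ALL ((v0 IN v1) IFF ((v0 IN v2) OR (v0 EQ v3))))

-- induction: φ has distinguished variable var 0, other free variables
-- are parameters.  In ∀x∀y(...), x = var 1 and y = var 0.
σx σy σxy : ℕ → Tm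
σx zero    = var 1
σx (suc n) = var (suc (suc n))
σy zero    = var 0
σy (suc n) = var (suc (suc n))
σxy zero    = var 1 ◁ var 0
σxy (suc n) = var (suc (suc n))

data IndAx : Fm → Set where
  ind : ∀ φ → IndAx (((φ [ zer ]) AND
                       ALL (ALL ((sub σx φ AND sub σy φ) IMP sub σxy φ)))
                     IMP ALL φ)

data Deriv (X : Fm) : List Fm → Fm → Set where
  hyp   : ∀ {H A} → A ∈ H → Deriv X H A
  extra : ∀ {H} → Deriv X H X
  bool  : ∀ {H A} → BoolAx A → Deriv X H A
  eq    : ∀ {H A} → EqAx A → Deriv X H A
  quant : ∀ {H A} → QuantAx A → Deriv X H A
  hf    : ∀ {H A} → HFAx A → Deriv X H A
  induc : ∀ {H A} → IndAx A → Deriv X H A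
  mp    : ∀ {H H' A B} → Deriv X H (A IMP B) → Deriv X H' A →
          Deriv X (H ++ H') B
  -- existential rule (de Bruijn form: the eigenvariable var 0 of A is
  -- not free in B or in H because these are shifted past it)
  exR   : ∀ {H A B} → Deriv X (map shift H) (A IMP shift B) →
          Deriv X H (EX A IMP B)

data StrictΣ : Fm → Set where
  sIn  : ∀ i j → StrictΣ (var i IN var j)
  sOr  : ∀ {A B} → StrictΣ A → StrictΣ B → StrictΣ (A OR B)
  sAnd : ∀ {A B} → StrictΣ A → StrictΣ B → StrictΣ (A AND B)
  sEx  : ∀ {A} → StrictΣ A → StrictΣ (EX A)
  -- ∀(x_i ∈ x_j) A with x_j (index j outside, suc j inside) not free in A;
  -- x_j ≠ x_i holds automatically for de Bruijn indices
  sAll : ∀ {A} j → StrictΣ A → ¬ Free (suc j) A → StrictΣ (ALL2 (var j) A)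

IsΣ : Fm → Fm → Set
IsΣ X A = Σ Fm λ B → StrictΣ B × (∀ n → Free n B → Free n A)
                      × Deriv X [] (A IFF B)

-- Standard model: hereditarily finite sets, built from ∅ and x ∪ {y},
-- with extensional equality _≈_ interpreting '='.

data HF : Set where
  ∅   : HF
  _⊲_ : HF → HF → HF

mutual
  _∈ₕ_ : HF → HF → Set
  x ∈ₕ ∅       = ⊥
  x ∈ₕ (a ⊲ b) = x ∈ₕ a ⊎ (x ⊆ₕ b × b ⊆ₕ x)

  _⊆ₕ_ : HF → HF → Set
  ∅       ⊆ₕ y = ⊤
  (a ⊲ b) ⊆ₕ y = a ⊆ₕ y × b ∈ₕ y

_≈ₕ_ : HF → HF → Set
x ≈ₕ y = x ⊆ₕ y × y ⊆ₕ x

Env : Set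
Env = ℕ → HF

_∷ₑ_ : HF → Env → Env
(x ∷ₑ ρ) zero    = x
(x ∷ₑ ρ) (suc n) = ρ n

evalT : Env → Tm → HF
evalT ρ (var n) = ρ n
evalT ρ zer     = ∅
evalT ρ (t ◁ u) = evalT ρ t ⊲ evalT ρ u

⟦_⟧ : Fm → Env → Set
⟦ t IN u ⟧ ρ = evalT ρ t ∈ₕ evalT ρ u
⟦ t EQ u ⟧ ρ = evalT ρ t ≈ₕ evalT ρ u
⟦ A OR B ⟧ ρ = ⟦ A ⟧ ρ ⊎ ⟦ B ⟧ ρ
⟦ NEG A ⟧ ρ  = ¬ ⟦ A ⟧ ρ
⟦ EX A ⟧ ρ   = Σ HF λ x → ⟦ A ⟧ (x ∷ₑ ρ)

-- truth of a sentence in the standard model (environment irrelevant)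
TrueHF : Fm → Set
TrueHF A = ⟦ A ⟧ (λ _ → ∅)

{-# OPTIONS --safe #-}
-- Soundness of the calculus for the standard model transfers the truth of A to its
-- strict Σ equivalent B (classically: the model interprets NEG as ¬, so excluded
-- middle is needed for the propositional axioms). Conversely every true strict Σ
-- sentence is derivable, by induction on its strict Σ derivation with hereditarily
-- finite sets named by closed numerals ⌜x⌝: membership and equality of numerals are
-- derived by a simultaneous recursion from HF2, an existential is witnessed by a
-- numeral, and a bounded ∀ over a numeral is a finite conjunction along the numeral.
-- Hence B, and with A ↔ B also A, is derivable.
module Submission where

open import Defs
open import Level using (0ℓ)
open import Axiom.ExcludedMiddle using (ExcludedMiddle)
open import Axiom.DoubleNegationElimination using (em⇒dne)
open import Data.Nat using (ℕ; zero; suc; _≟_)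
open import Data.Bool using (Bool; false; _∧_; T)
open import Data.Bool.Properties using (T-∧)
open import Data.Unit using (tt)
open import Data.Empty using (⊥-elim)
open import Data.Sum using (_⊎_; inj₁; inj₂) renaming (map to ⊎-map)
open import Data.Product using (Σ; _,_; proj₁; proj₂)
open import Data.List using (List; []; _∷_; _++_)
open import Data.List.Properties using (++-conicalˡ; ++-conicalʳ)
open import Data.List.Relation.Unary.Any using (here; there; any?)
open import Function using (_∘_; _⇔_; mk⇔; Equivalence)
open import Relation.Nullary using (¬_; yes; no; map′)
open import Relation.Nullary.Decidable using (isYes; toWitness)
open import Relation.Binary.Definitions using (DecidableEquality)
open import Relation.Binary.PropositionalEquality hiding ([_])
open Equivalence using (to; from)

Subst : Set
Subst = ℕ → Tm

infixr 5 _∷ₛ_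
_∷ₛ_ : Tm → Subst → Subst
(t ∷ₛ σ) zero    = t
(t ∷ₛ σ) (suc n) = σ n

subT-ext : ∀ {σ τ} → (∀ n → σ n ≡ τ n) → ∀ t → subT σ t ≡ subT τ t
subT-ext h (var n) = h n
subT-ext h zer     = refl
subT-ext h (t ◁ u) = cong₂ _◁_ (subT-ext h t) (subT-ext h u)

subT-var : ∀ t → subT var t ≡ t
subT-var (var n) = refl
subT-var zer     = refl
subT-var (t ◁ u) = cong₂ _◁_ (subT-var t) (subT-var u)

renT-as-subT : ∀ r t → renT r t ≡ subT (var ∘ r) t
renT-as-subT r (var n) = refl
renT-as-subT r zer     = refl
renT-as-subT r (t ◁ u) = cong₂ _◁_ (renT-as-subT r t) (renT-as-subT r u)

renT-renT : ∀ r r′ t → renT r (renT r′ t) ≡ renT (r ∘ r′) t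
renT-renT r r′ (var n) = refl
renT-renT r r′ zer     = refl
renT-renT r r′ (t ◁ u) = cong₂ _◁_ (renT-renT r r′ t) (renT-renT r r′ u)

subT-renT : ∀ σ r t → subT σ (renT r t) ≡ subT (σ ∘ r) t
subT-renT σ r (var n) = refl
subT-renT σ r zer     = refl
subT-renT σ r (t ◁ u) = cong₂ _◁_ (subT-renT σ r t) (subT-renT σ r u)

renT-subT : ∀ r σ t → renT r (subT σ t) ≡ subT (renT r ∘ σ) t
renT-subT r σ (var n) = refl
renT-subT r σ zer     = refl
renT-subT r σ (t ◁ u) = cong₂ _◁_ (renT-subT r σ t) (renT-subT r σ u)

subT-subT : ∀ σ τ t → subT σ (subT τ t) ≡ subT (subT σ ∘ τ) t
subT-subT σ τ (var n) = refl
subT-subT σ τ zer     = refl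
subT-subT σ τ (t ◁ u) = cong₂ _◁_ (subT-subT σ τ t) (subT-subT σ τ u)

subT-id-free : ∀ {σ} t → (∀ n → FreeT n t → σ n ≡ var n) → subT σ t ≡ t
subT-id-free (var m) h = h m refl
subT-id-free zer     h = refl
subT-id-free (t ◁ u) h =
  cong₂ _◁_ (subT-id-free t (λ n → h n ∘ inj₁)) (subT-id-free u (λ n → h n ∘ inj₂))

subT-extS-shiftT : ∀ σ t → subT (extS σ) (shiftT t) ≡ shiftT (subT σ t)
subT-extS-shiftT σ t = trans (subT-renT (extS σ) suc t) (sym (renT-subT suc σ t))

subT-sub0-shiftT : ∀ t u → subT (sub0 t) (shiftT u) ≡ u
subT-sub0-shiftT t u = trans (subT-renT (sub0 t) suc u) (subT-var u)

extS-ext : ∀ {σ τ} → (∀ n → σ n ≡ τ n) → ∀ n → extS σ n ≡ extS τ n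
extS-ext h zero    = refl
extS-ext h (suc n) = cong shiftT (h n)

sub-ext : ∀ {σ τ} → (∀ n → σ n ≡ τ n) → ∀ A → sub σ A ≡ sub τ A
sub-ext h (t IN u) = cong₂ _IN_ (subT-ext h t) (subT-ext h u)
sub-ext h (t EQ u) = cong₂ _EQ_ (subT-ext h t) (subT-ext h u)
sub-ext h (A OR B) = cong₂ _OR_ (sub-ext h A) (sub-ext h B)
sub-ext h (NEG A)  = cong NEG (sub-ext h A)
sub-ext h (EX A)   = cong EX (sub-ext (extS-ext h) A)

sub-var : ∀ A → sub var A ≡ A
sub-var (t IN u) = cong₂ _IN_ (subT-var t) (subT-var u)
sub-var (t EQ u) = cong₂ _EQ_ (subT-var t) (subT-var u)
sub-var (A OR B) = cong₂ _OR_ (sub-var A) (sub-var B)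
sub-var (NEG A)  = cong NEG (sub-var A)
sub-var (EX A)   = cong EX (trans (sub-ext extS-var A) (sub-var A))
  where
  extS-var : ∀ n → extS var n ≡ var n
  extS-var zero    = refl
  extS-var (suc n) = refl

ren-as-sub : ∀ r A → ren r A ≡ sub (var ∘ r) A
ren-as-sub r (t IN u) = cong₂ _IN_ (renT-as-subT r t) (renT-as-subT r u)
ren-as-sub r (t EQ u) = cong₂ _EQ_ (renT-as-subT r t) (renT-as-subT r u)
ren-as-sub r (A OR B) = cong₂ _OR_ (ren-as-sub r A) (ren-as-sub r B)
ren-as-sub r (NEG A)  = cong NEG (ren-as-sub r A)
ren-as-sub r (EX A)   = cong EX (trans (ren-as-sub (extR r) A) (sub-ext extR-as-extS A))
  where
  extR-as-extS : ∀ n → var (extR r n) ≡ extS (var ∘ r) n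
  extR-as-extS zero    = refl
  extR-as-extS (suc n) = refl

sub-sub : ∀ σ τ A → sub σ (sub τ A) ≡ sub (subT σ ∘ τ) A
sub-sub σ τ (t IN u) = cong₂ _IN_ (subT-subT σ τ t) (subT-subT σ τ u)
sub-sub σ τ (t EQ u) = cong₂ _EQ_ (subT-subT σ τ t) (subT-subT σ τ u)
sub-sub σ τ (A OR B) = cong₂ _OR_ (sub-sub σ τ A) (sub-sub σ τ B)
sub-sub σ τ (NEG A)  = cong NEG (sub-sub σ τ A)
sub-sub σ τ (EX A)   = cong EX (trans (sub-sub (extS σ) (extS τ) A) (sub-ext extS-subT A))
  where
  extS-subT : ∀ n → subT (extS σ) (extS τ n) ≡ extS (subT σ ∘ τ) n
  extS-subT zero    = refl
  extS-subT (suc n) = subT-extS-shiftT σ (τ n)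

sub-ren : ∀ σ r A → sub σ (ren r A) ≡ sub (σ ∘ r) A
sub-ren σ r A = trans (cong (sub σ) (ren-as-sub r A)) (sub-sub σ (var ∘ r) A)

ren-sub : ∀ r σ A → ren r (sub σ A) ≡ sub (renT r ∘ σ) A
ren-sub r σ A = begin
  ren r (sub σ A)                ≡⟨ ren-as-sub r (sub σ A) ⟩
  sub (var ∘ r) (sub σ A)        ≡⟨ sub-sub (var ∘ r) σ A ⟩
  sub (subT (var ∘ r) ∘ σ) A     ≡⟨ sub-ext (λ n → sym (renT-as-subT r (σ n))) A ⟩
  sub (renT r ∘ σ) A             ∎
  where open ≡-Reasoning

sub-id-free : ∀ {σ} A → (∀ n → Free n A → σ n ≡ var n) → sub σ A ≡ A
sub-id-free (t IN u) h = cong₂ _IN_ (subT-id-free t (λ n → h n ∘ inj₁)) (subT-id-free u (λ n → h n ∘ inj₂))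
sub-id-free (t EQ u) h = cong₂ _EQ_ (subT-id-free t (λ n → h n ∘ inj₁)) (subT-id-free u (λ n → h n ∘ inj₂))
sub-id-free (A OR B) h = cong₂ _OR_ (sub-id-free A (λ n → h n ∘ inj₁)) (sub-id-free B (λ n → h n ∘ inj₂))
sub-id-free (NEG A)  h = cong NEG (sub-id-free A h)
sub-id-free {σ} (EX A) h = cong EX (sub-id-free A extS-id)
  where
  extS-id : ∀ n → Free n A → extS σ n ≡ var n
  extS-id zero    _ = refl
  extS-id (suc n) f = cong shiftT (h n f)

sentence-sub : ∀ {A} → Sentence A → ∀ σ → sub σ A ≡ A
sentence-sub {A} closed σ = sub-id-free A (λ n f → ⊥-elim (closed n f))

[]-as-sub : ∀ σ t A → sub (extS σ) A [ t ] ≡ sub (t ∷ₛ σ) A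
[]-as-sub σ t A = trans (sub-sub (sub0 t) (extS σ) A) (sub-ext sub0-extS A)
  where
  sub0-extS : ∀ n → subT (sub0 t) (extS σ n) ≡ (t ∷ₛ σ) n
  sub0-extS zero    = refl
  sub0-extS (suc n) = subT-sub0-shiftT t (σ n)

sub-[] : ∀ σ A t → sub σ (A [ t ]) ≡ sub (extS σ) A [ subT σ t ]
sub-[] σ A t = begin
  sub σ (A [ t ])                   ≡⟨ sub-sub σ (sub0 t) A ⟩
  sub (subT σ ∘ sub0 t) A           ≡⟨ sub-ext subT-sub0 A ⟩
  sub (subT σ t ∷ₛ σ) A             ≡⟨ sym ([]-as-sub σ (subT σ t) A) ⟩
  sub (extS σ) A [ subT σ t ]       ∎
  where
  open ≡-Reasoning
  subT-sub0 : ∀ n → subT σ (sub0 t n) ≡ (subT σ t ∷ₛ σ) n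
  subT-sub0 zero    = refl
  subT-sub0 (suc n) = refl

module Propositional (X : Fm) where

  infix 2 ⊢_
  ⊢_ : Fm → Set
  ⊢ A = Deriv X [] A

  infixl 4 _·_
  _·_ : ∀ {A B} → ⊢ (A IMP B) → ⊢ A → ⊢ B
  d · e = mp d e

  cut : ∀ {A B C} → ⊢ (C OR A) → ⊢ (NEG C OR B) → ⊢ (A OR B)
  cut {A} {B} {C} d e = bool (disjConj A B C) · d · e

  ∨-comm : ∀ {A B} → ⊢ (A OR B) → ⊢ (B OR A)
  ∨-comm {A} d = cut d (bool (ident A))

  ∨-introˡ : ∀ {A B} → ⊢ A → ⊢ (A OR B)
  ∨-introˡ {A} {B} d = bool (disjI1 A B) · d

  ∨-introʳ : ∀ {A B} → ⊢ A → ⊢ (B OR A)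
  ∨-introʳ d = ∨-comm (∨-introˡ d)

  ∨-contract : ∀ {A} → ⊢ (A OR A) → ⊢ A
  ∨-contract {A} d = bool (disjCont A) · d

  ∨-assoc : ∀ {A B C} → ⊢ (A OR (B OR C)) → ⊢ ((A OR B) OR C)
  ∨-assoc {A} {B} {C} d = bool (disjAssoc A B C) · d

  ∨-assoc⁻ : ∀ {A B C} → ⊢ ((A OR B) OR C) → ⊢ (A OR (B OR C))
  ∨-assoc⁻ d = ∨-comm (∨-assoc (∨-comm (∨-assoc (∨-comm d))))

  ∨-mapʳ : ∀ {G A B} → ⊢ (G OR A) → ⊢ (A IMP B) → ⊢ (G OR B)
  ∨-mapʳ d e = cut (∨-comm d) e

  ∨-elim : ∀ {A B G} → ⊢ (A IMP G) → ⊢ (B IMP G) → ⊢ ((A OR B) IMP G)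
  ∨-elim {A} {B} {G} da db =
    ∨-mapʳ (∨-assoc⁻ (∨-comm (∨-assoc⁻ (cut (∨-comm (∨-assoc (∨-comm
      (cut (∨-comm (∨-assoc (bool (ident (A OR B))))) db)))) da))))
      (bool (disjCont G))

  OR-congʳ : ∀ {A B C} → ⊢ (A IMP B) → ⊢ ((C OR A) IMP (C OR B))
  OR-congʳ {A} {C = C} d = ∨-assoc⁻ (∨-mapʳ (∨-assoc (bool (ident (C OR A)))) d)

  OR-comm : ∀ {A B} → ⊢ ((A OR B) IMP (B OR A))
  OR-comm {A} {B} = ∨-elim (∨-comm (∨-assoc (∨-comm (∨-introˡ (∨-comm (bool (ident A)))))))
                           (bool (disjI1 B A))

  OR-congˡ : ∀ {A B C} → ⊢ (A IMP B) → ⊢ ((A OR C) IMP (B OR C))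
  OR-congˡ d = ∨-mapʳ OR-comm (∨-mapʳ (OR-congʳ d) OR-comm)

  OR-assoc : ∀ {A B C} → ⊢ ((A OR (B OR C)) IMP ((A OR B) OR C))
  OR-assoc {A} {B} {C} = bool (disjAssoc A B C)

  OR-swap : ∀ {A B C} → ⊢ ((A OR (B OR C)) IMP (B OR (A OR C)))
  OR-swap = ∨-mapʳ OR-assoc (∨-mapʳ (OR-congˡ OR-comm) OR-assoc⁻)
    where
    OR-assoc⁻ : ∀ {A B C} → ⊢ (((A OR B) OR C) IMP (A OR (B OR C)))
    OR-assoc⁻ = ∨-mapʳ OR-comm (∨-mapʳ OR-assoc (∨-mapʳ OR-comm (∨-mapʳ OR-assoc OR-comm)))

  ¬¬-intro : ∀ {A} → ⊢ (A IMP NEG (NEG A))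
  ¬¬-intro {A} = ∨-comm (bool (ident (NEG A)))

  ¬¬-introˡ : ∀ {A G} → ⊢ (A OR G) → ⊢ (NEG (NEG A) OR G)
  ¬¬-introˡ d = ∨-comm (∨-mapʳ (∨-comm d) ¬¬-intro)

  verum : Fm
  verum = zer IN zer IMP zer IN zer

  ∨-falsumʳ : ∀ {A} → ⊢ (A OR NEG verum) → ⊢ A
  ∨-falsumʳ d = ∨-contract (cut (∨-introˡ (bool (ident (zer IN zer)))) (∨-comm d))

  infixr 6 _∨ₚ_
  data PForm : Set where
    atom : ℕ → PForm
    _∨ₚ_ : PForm → PForm → PForm
    ¬ₚ_  : PForm → PForm

  ⟪_⟫ : PForm → (ℕ → Fm) → Fm
  ⟪ atom n ⟫ e = e n
  ⟪ p ∨ₚ q ⟫ e = ⟪ p ⟫ e OR ⟪ q ⟫ e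
  ⟪ ¬ₚ p ⟫ e   = NEG (⟪ p ⟫ e)

  _≟ₚ_ : DecidableEquality PForm
  atom m ≟ₚ atom n = map′ (cong atom) (λ { refl → refl }) (m ≟ n)
  (p ∨ₚ q) ≟ₚ (p′ ∨ₚ q′) with p ≟ₚ p′ | q ≟ₚ q′
  ... | yes refl | yes refl = yes refl
  ... | no p≢p′  | _        = no λ { refl → p≢p′ refl }
  ... | yes _    | no q≢q′  = no λ { refl → q≢q′ refl }
  (¬ₚ p) ≟ₚ (¬ₚ q) = map′ (cong ¬ₚ_) (λ { refl → refl }) (p ≟ₚ q)
  atom _   ≟ₚ (_ ∨ₚ _) = no λ ()
  atom _   ≟ₚ (¬ₚ _)   = no λ ()
  (_ ∨ₚ _) ≟ₚ atom _   = no λ ()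
  (_ ∨ₚ _) ≟ₚ (¬ₚ _)   = no λ ()
  (¬ₚ _)   ≟ₚ atom _   = no λ ()
  (¬ₚ _)   ≟ₚ (_ ∨ₚ _) = no λ ()

  open import Data.List.Membership.DecPropositional _≟ₚ_ using (_∈_; _∈?_; find)

  ⋁ : (ℕ → Fm) → List PForm → Fm
  ⋁ e []      = NEG verum
  ⋁ e (p ∷ Γ) = ⟪ p ⟫ e OR ⋁ e Γ

  ⋁-absorb : ∀ e {p Γ} → p ∈ Γ → ⊢ ((⟪ p ⟫ e OR ⋁ e Γ) IMP ⋁ e Γ)
  ⋁-absorb e {p} (here refl) = ∨-mapʳ OR-assoc (OR-congˡ (bool (disjCont (⟪ p ⟫ e))))
  ⋁-absorb e (there p∈Γ)     = ∨-mapʳ OR-swap (OR-congʳ (⋁-absorb e p∈Γ))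

  ⋁-complement : ∀ e {p Γ} → (¬ₚ p) ∈ Γ → ⊢ ⋁ e (p ∷ Γ)
  ⋁-complement e {p} (here refl) = ∨-assoc⁻ (∨-introˡ (∨-comm (bool (ident (⟪ p ⟫ e)))))
  ⋁-complement e (there ¬p∈Γ)    = OR-swap · ∨-introʳ (⋁-complement e ¬p∈Γ)

  ⋁-move : ∀ e p Γ Λ → ⊢ (⋁ e (Γ ++ p ∷ Λ) IMP ⋁ e (p ∷ Γ ++ Λ))
  ⋁-move e p []      Λ = bool (ident _)
  ⋁-move e p (q ∷ Γ) Λ = ∨-mapʳ (OR-congʳ (⋁-move e p Γ Λ)) OR-swap

  closes : List PForm → Bool
  closes Λ = isYes (any? (λ p → (¬ₚ p) ∈? Λ) Λ)

  closes-sound : ∀ e Λ → T (closes Λ) → ⊢ ⋁ e Λ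
  closes-sound e Λ h with find (toWitness h)
  ... | _ , p∈Λ , ¬p∈Λ = ⋁-absorb e p∈Λ · ⋁-complement e ¬p∈Λ

  -- Proof search in a one-sided sequent calculus: Γ holds the formulas still to be
  -- decomposed, Λ the literals reached so far; the fuel k only bounds the search.
  provable : ℕ → List PForm → List PForm → Bool
  provable zero    _                     _ = false
  provable (suc k) []                    Λ = closes Λ
  provable (suc k) (atom n ∷ Γ)          Λ = provable k Γ (atom n ∷ Λ)
  provable (suc k) ((p ∨ₚ q) ∷ Γ)        Λ = provable k (p ∷ q ∷ Γ) Λ
  provable (suc k) ((¬ₚ atom n) ∷ Γ)     Λ = provable k Γ ((¬ₚ atom n) ∷ Λ)
  provable (suc k) ((¬ₚ (p ∨ₚ q)) ∷ Γ)   Λ = provable k ((¬ₚ p) ∷ Γ) Λ ∧ provable k ((¬ₚ q) ∷ Γ) Λ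
  provable (suc k) ((¬ₚ (¬ₚ p)) ∷ Γ)     Λ = provable k (p ∷ Γ) Λ

  provable-sound : ∀ k Γ Λ → T (provable k Γ Λ) → ∀ e → ⊢ ⋁ e (Γ ++ Λ)
  provable-sound (suc k) [] Λ h e = closes-sound e Λ h
  provable-sound (suc k) (atom n ∷ Γ) Λ h e =
    ⋁-move e (atom n) Γ Λ · provable-sound k Γ (atom n ∷ Λ) h e
  provable-sound (suc k) ((p ∨ₚ q) ∷ Γ) Λ h e = ∨-assoc (provable-sound k (p ∷ q ∷ Γ) Λ h e)
  provable-sound (suc k) ((¬ₚ atom n) ∷ Γ) Λ h e =
    ⋁-move e (¬ₚ atom n) Γ Λ · provable-sound k Γ ((¬ₚ atom n) ∷ Λ) h e
  provable-sound (suc k) ((¬ₚ (p ∨ₚ q)) ∷ Γ) Λ h e =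
    ∨-elim (provable-sound k ((¬ₚ p) ∷ Γ) Λ (proj₁ (to T-∧ h)) e)
           (provable-sound k ((¬ₚ q) ∷ Γ) Λ (proj₂ (to T-∧ h)) e)
  provable-sound (suc k) ((¬ₚ (¬ₚ p)) ∷ Γ) Λ h e = ¬¬-introˡ (provable-sound k (p ∷ Γ) Λ h e)

  atoms : List Fm → ℕ → Fm
  atoms []       n       = verum
  atoms (A ∷ As) zero    = A
  atoms (A ∷ As) (suc n) = atoms As n

  -- On a tautology the type of the implicit argument reduces to ⊤, so Agda fills it in.
  taut : (φ : PForm) {valid : T (provable 200 (φ ∷ []) [])} (As : List Fm) → ⊢ ⟪ φ ⟫ (atoms As)
  taut φ {valid} As = ∨-falsumʳ (provable-sound 200 (φ ∷ []) [] valid (atoms As))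

  infixr 5 _⇒ₚ_ _⇔ₚ_
  infixr 6 _∧ₚ_
  _⇒ₚ_ : PForm → PForm → PForm
  p ⇒ₚ q = (¬ₚ p) ∨ₚ q
  _∧ₚ_ : PForm → PForm → PForm
  p ∧ₚ q = ¬ₚ ((¬ₚ p) ∨ₚ (¬ₚ q))
  _⇔ₚ_ : PForm → PForm → PForm
  p ⇔ₚ q = (p ⇒ₚ q) ∧ₚ (q ⇒ₚ p)

  a₀ a₁ a₂ a₃ a₄ : PForm
  a₀ = atom 0
  a₁ = atom 1
  a₂ = atom 2
  a₃ = atom 3
  a₄ = atom 4

module FirstOrder (X : Fm) (X-closed : Sentence X) where
  open Propositional X public

  ALL-intro : ∀ {A} → ⊢ A → ⊢ ALL A
  ALL-intro {A} d = ∨-contract (exR (∨-introˡ {B = shift (ALL A)} (¬¬-intro · d)))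

  ALL-inst : ∀ {B} → ⊢ ALL B → ∀ t → ⊢ B [ t ]
  ALL-inst {B} d t =
    taut ((¬ₚ (¬ₚ a₀)) ∨ₚ a₁ ⇒ₚ ¬ₚ a₁ ⇒ₚ a₀) (B [ t ] ∷ EX (NEG B) ∷ []) · quant (exI (NEG B) t) · d

  EX-intro : ∀ {A} t → ⊢ A [ t ] → ⊢ EX A
  EX-intro {A} t d = quant (exI A t) · d

  infixr 5 _++ₛ_
  _++ₛ_ : List Tm → Subst → Subst
  []       ++ₛ σ = σ
  (t ∷ ts) ++ₛ σ = t ∷ₛ (ts ++ₛ σ)

  ALL⋆ : List Tm → Fm → Fm
  ALL⋆ []       A = A
  ALL⋆ (t ∷ ts) A = ALL⋆ ts (ALL A)

  ALL⋆-intro : ∀ ts {A} → ⊢ A → ⊢ ALL⋆ ts A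
  ALL⋆-intro []       d = d
  ALL⋆-intro (t ∷ ts) d = ALL⋆-intro ts (ALL-intro d)

  ALL⋆-inst : ∀ ts {A} → ⊢ ALL⋆ ts A → ⊢ sub (ts ++ₛ var) A
  ALL⋆-inst []       {A} d = subst ⊢_ (sym (sub-var A)) d
  ALL⋆-inst (t ∷ ts) {A} d = subst ⊢_ ([]-as-sub (ts ++ₛ var) t A) (ALL-inst (ALL⋆-inst ts d) t)

  inst₄ : ∀ {A} → ⊢ A → (σ : Subst) → ⊢ sub ((σ 0 ∷ σ 1 ∷ σ 2 ∷ σ 3 ∷ []) ++ₛ var) A
  inst₄ d σ = ALL⋆-inst ts (ALL⋆-intro ts d)
    where ts = σ 0 ∷ σ 1 ∷ σ 2 ∷ σ 3 ∷ []

  -- The equality and HF axioms mention only var 0 … var 3, so the instance built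
  -- by inst₄ is literally sub σ A.
  EqAx-sub : ∀ {A} → EqAx A → ∀ σ → ⊢ sub σ A
  EqAx-sub eqRefl σ = inst₄ (eq eqRefl) σ
  EqAx-sub eqIn   σ = inst₄ (eq eqIn) σ
  EqAx-sub eqEq   σ = inst₄ (eq eqEq) σ
  EqAx-sub eqEats σ = inst₄ (eq eqEats) σ

  HFAx-sub : ∀ {A} → HFAx A → ∀ σ → ⊢ sub σ A
  HFAx-sub hf1 σ = inst₄ (hf hf1) σ
  HFAx-sub hf2 σ = inst₄ (hf hf2) σ

  BoolAx-sub : ∀ {A} → BoolAx A → ∀ σ → BoolAx (sub σ A)
  BoolAx-sub (ident A)         σ = ident _
  BoolAx-sub (disjI1 A B)      σ = disjI1 _ _
  BoolAx-sub (disjCont A)      σ = disjCont _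
  BoolAx-sub (disjAssoc A B C) σ = disjAssoc _ _ _
  BoolAx-sub (disjConj A B C)  σ = disjConj _ _ _

  induction-sub : ∀ σ ξ → (∀ n → ξ (suc n) ≡ var (suc (suc n))) →
                  subT (extS (extS σ)) (ξ 0) ≡ ξ 0 →
                  ∀ φ → sub (extS (extS σ)) (sub ξ φ) ≡ sub ξ (sub (extS σ) φ)
  induction-sub σ ξ ξ-suc ξ-zero φ =
    trans (sub-sub _ ξ φ) (trans (sub-ext commutes φ) (sym (sub-sub ξ (extS σ) φ)))
    where
    commutes : ∀ n → subT (extS (extS σ)) (ξ n) ≡ subT ξ (extS σ n)
    commutes zero = ξ-zero
    commutes (suc n) rewrite ξ-suc n = begin
      shiftT (shiftT (σ n))          ≡⟨ renT-renT suc suc (σ n) ⟩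
      renT (suc ∘ suc) (σ n)         ≡⟨ renT-as-subT (suc ∘ suc) (σ n) ⟩
      subT (var ∘ suc ∘ suc) (σ n)   ≡⟨ subT-ext (λ m → sym (ξ-suc m)) (σ n) ⟩
      subT (ξ ∘ suc) (σ n)           ≡⟨ sym (subT-renT ξ suc (σ n)) ⟩
      subT ξ (shiftT (σ n))          ∎
      where open ≡-Reasoning

  ⊢-sub′ : ∀ {H A} → Deriv X H A → H ≡ [] → ∀ σ → ⊢ sub σ A
  ⊢-sub′ (hyp ()) refl σ
  ⊢-sub′ extra _ σ = subst ⊢_ (sym (sentence-sub X-closed σ)) extra
  ⊢-sub′ (bool ax) _ σ = bool (BoolAx-sub ax σ)
  ⊢-sub′ (eq ax) _ σ = EqAx-sub ax σ
  ⊢-sub′ (quant (exI A t)) _ σ =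
    subst (λ B → ⊢ (NEG B OR EX (sub (extS σ) A))) (sym (sub-[] σ A t)) (quant (exI _ _))
  ⊢-sub′ (hf ax) _ σ = HFAx-sub ax σ
  ⊢-sub′ (induc (ind φ)) _ σ
    rewrite sub-[] σ φ zer
          | induction-sub σ σx (λ _ → refl) refl φ
          | induction-sub σ σy (λ _ → refl) refl φ
          | induction-sub σ σxy (λ _ → refl) refl φ = induc (ind (sub (extS σ) φ))
  ⊢-sub′ (mp {H = H} {H′} d e) H++H′≡[] σ =
    ⊢-sub′ d (++-conicalˡ H H′ H++H′≡[]) σ · ⊢-sub′ e (++-conicalʳ H H′ H++H′≡[]) σ
  ⊢-sub′ (exR {A = A} {B} d) refl σ =
    exR (subst (λ C → ⊢ (sub (extS σ) A IMP C)) sub-shift (⊢-sub′ d refl (extS σ)))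
    where
    sub-shift : sub (extS σ) (shift B) ≡ shift (sub σ B)
    sub-shift = trans (sub-ren (extS σ) suc B) (sym (ren-sub suc σ B))

  ⊢-sub : ∀ {A} → ⊢ A → ∀ σ → ⊢ sub σ A
  ⊢-sub d = ⊢-sub′ d refl

  ⊢-shift : ∀ {A} → ⊢ A → ⊢ shift A
  ⊢-shift {A} d = subst ⊢_ (sym (ren-as-sub suc A)) (⊢-sub d (var ∘ suc))

  IMP-shift-EX : ∀ A → ⊢ (A IMP shift (EX A))
  IMP-shift-EX A = subst (λ B → ⊢ (NEG B OR shift (EX A))) var0-inst (quant (exI (ren (extR suc) A) (var 0)))
    where
    var0-inst : ren (extR suc) A [ var 0 ] ≡ A
    var0-inst = trans (sub-ren (sub0 (var 0)) (extR suc) A) (trans (sub-ext (λ { zero → refl ; (suc n) → refl }) A) (sub-var A))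

  ALL-elim : ∀ {P} → ⊢ ALL P → ⊢ P
  ALL-elim {P} d =
    taut ((¬ₚ a₀ ⇒ₚ a₁) ⇒ₚ ¬ₚ a₁ ⇒ₚ a₀) (P ∷ shift (EX (NEG P)) ∷ []) · IMP-shift-EX (NEG P) · ⊢-shift d

  ALL-map : ∀ {P Q} → ⊢ ALL P → ⊢ (P IMP Q) → ⊢ ALL Q
  ALL-map d e = ALL-intro (e · ALL-elim d)

  EQ-refl : ∀ t → ⊢ (t EQ t)
  EQ-refl t = EqAx-sub eqRefl (λ _ → t)

  EQ-IN : ∀ a b c d → ⊢ (((a EQ b) AND (c EQ d)) IMP ((a IN c) IMP (b IN d)))
  EQ-IN a b c d = EqAx-sub eqIn ((a ∷ b ∷ c ∷ d ∷ []) ++ₛ var)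

  EQ-EQ : ∀ a b c d → ⊢ (((a EQ b) AND (c EQ d)) IMP ((a EQ c) IMP (b EQ d)))
  EQ-EQ a b c d = EqAx-sub eqEq ((a ∷ b ∷ c ∷ d ∷ []) ++ₛ var)

  EQ-◁ : ∀ a b c d → ⊢ (((a EQ b) AND (c EQ d)) IMP ((a ◁ c) EQ (b ◁ d)))
  EQ-◁ a b c d = EqAx-sub eqEats ((a ∷ b ∷ c ∷ d ∷ []) ++ₛ var)

  EQ-sym : ∀ a b → ⊢ ((a EQ b) IMP (b EQ a))
  EQ-sym a b = taut (((a₀ ∧ₚ a₁) ⇒ₚ (a₁ ⇒ₚ a₂)) ⇒ₚ a₁ ⇒ₚ (a₀ ⇒ₚ a₂)) ((a EQ b) ∷ (a EQ a) ∷ (b EQ a) ∷ [])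
               · EQ-EQ a b a a · EQ-refl a

  EQ-subT : ∀ E σ τ → (∀ n → ⊢ (E IMP (σ n EQ τ n))) → ∀ t → ⊢ (E IMP (subT σ t EQ subT τ t))
  EQ-subT E σ τ h (var n) = h n
  EQ-subT E σ τ h zer     = taut (a₁ ⇒ₚ (a₀ ⇒ₚ a₁)) (E ∷ (zer EQ zer) ∷ []) · EQ-refl zer
  EQ-subT E σ τ h (t ◁ u) =
    taut ((a₀ ⇒ₚ a₁) ⇒ₚ (a₀ ⇒ₚ a₂) ⇒ₚ ((a₁ ∧ₚ a₂) ⇒ₚ a₃) ⇒ₚ (a₀ ⇒ₚ a₃))
         (E ∷ (subT σ t EQ subT τ t) ∷ (subT σ u EQ subT τ u) ∷ ((subT σ t ◁ subT σ u) EQ (subT τ t ◁ subT τ u)) ∷ [])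
      · EQ-subT E σ τ h t · EQ-subT E σ τ h u · EQ-◁ _ _ _ _

  EQ-sub : ∀ A E σ τ → (∀ n → ⊢ (E IMP (σ n EQ τ n))) → ⊢ (E IMP (sub σ A IMP sub τ A))
  EQ-sub (t IN u) E σ τ h =
    taut ((a₀ ⇒ₚ a₁) ⇒ₚ (a₀ ⇒ₚ a₂) ⇒ₚ ((a₁ ∧ₚ a₂) ⇒ₚ (a₃ ⇒ₚ a₄)) ⇒ₚ (a₀ ⇒ₚ (a₃ ⇒ₚ a₄)))
         (E ∷ (subT σ t EQ subT τ t) ∷ (subT σ u EQ subT τ u) ∷ (subT σ t IN subT σ u) ∷ (subT τ t IN subT τ u) ∷ [])
      · EQ-subT E σ τ h t · EQ-subT E σ τ h u · EQ-IN _ _ _ _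
  EQ-sub (t EQ u) E σ τ h =
    taut ((a₀ ⇒ₚ a₁) ⇒ₚ (a₀ ⇒ₚ a₂) ⇒ₚ ((a₁ ∧ₚ a₂) ⇒ₚ (a₃ ⇒ₚ a₄)) ⇒ₚ (a₀ ⇒ₚ (a₃ ⇒ₚ a₄)))
         (E ∷ (subT σ t EQ subT τ t) ∷ (subT σ u EQ subT τ u) ∷ (subT σ t EQ subT σ u) ∷ (subT τ t EQ subT τ u) ∷ [])
      · EQ-subT E σ τ h t · EQ-subT E σ τ h u · EQ-EQ _ _ _ _
  EQ-sub (A OR B) E σ τ h =
    taut ((a₀ ⇒ₚ a₁ ⇒ₚ a₂) ⇒ₚ (a₀ ⇒ₚ a₃ ⇒ₚ a₄) ⇒ₚ (a₀ ⇒ₚ (a₁ ∨ₚ a₃) ⇒ₚ (a₂ ∨ₚ a₄)))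
         (E ∷ sub σ A ∷ sub τ A ∷ sub σ B ∷ sub τ B ∷ [])
      · EQ-sub A E σ τ h · EQ-sub B E σ τ h
  EQ-sub (NEG A) E σ τ h =
    taut ((a₀ ⇒ₚ a₁ ⇒ₚ a₂) ⇒ₚ (a₀ ⇒ₚ (¬ₚ a₂) ⇒ₚ (¬ₚ a₁))) (E ∷ sub τ A ∷ sub σ A ∷ [])
      · EQ-sub A E τ σ (λ n → ∨-mapʳ (h n) (EQ-sym _ _))
  EQ-sub (EX A) E σ τ h =
    taut ((a₁ ⇒ₚ a₀ ⇒ₚ a₂) ⇒ₚ (a₀ ⇒ₚ a₁ ⇒ₚ a₂)) (E ∷ EX Aσ ∷ EX Aτ ∷ [])
      · exR (taut ((a₀ ⇒ₚ a₁ ⇒ₚ a₂) ⇒ₚ (a₂ ⇒ₚ a₃) ⇒ₚ (a₁ ⇒ₚ ((¬ₚ a₀) ∨ₚ a₃))) (shift E ∷ Aσ ∷ Aτ ∷ shift (EX Aτ) ∷ [])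
               · EQ-sub A (shift E) (extS σ) (extS τ) extS-EQ · IMP-shift-EX Aτ)
    where
    Aσ Aτ : Fm
    Aσ = sub (extS σ) A
    Aτ = sub (extS τ) A
    extS-EQ : ∀ n → ⊢ (shift E IMP (extS σ n EQ extS τ n))
    extS-EQ zero    = taut (a₁ ⇒ₚ (a₀ ⇒ₚ a₁)) (shift E ∷ (var 0 EQ var 0) ∷ []) · EQ-refl (var 0)
    extS-EQ (suc n) = ⊢-shift (h n)

⊆-weaken : ∀ {x y} z → x ⊆ₕ y → x ⊆ₕ (y ⊲ z)
⊆-weaken {∅}     z _       = tt
⊆-weaken {a ⊲ b} z (s , m) = ⊆-weaken z s , inj₁ m

⊆-refl : ∀ x → x ⊆ₕ x
⊆-refl ∅       = tt
⊆-refl (a ⊲ b) = ⊆-weaken b (⊆-refl a) , inj₂ (⊆-refl b , ⊆-refl b)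

≈-refl : ∀ {x} → x ≈ₕ x
≈-refl {x} = ⊆-refl x , ⊆-refl x

≈-sym : ∀ {x y} → x ≈ₕ y → y ≈ₕ x
≈-sym (p , q) = q , p

mutual
  ⊆-trans : ∀ x y z → x ⊆ₕ y → y ⊆ₕ z → x ⊆ₕ z
  ⊆-trans ∅       y z _       _ = tt
  ⊆-trans (a ⊲ b) y z (p , m) q = ⊆-trans a y z p q , ∈-resp-⊆ b y z m q

  ∈-resp-⊆ : ∀ x y z → x ∈ₕ y → y ⊆ₕ z → x ∈ₕ z
  ∈-resp-⊆ x (a ⊲ b) z (inj₁ m) (s , _)  = ∈-resp-⊆ x a z m s
  ∈-resp-⊆ x (a ⊲ b) z (inj₂ e) (_ , m′) = ∈-respˡ-≈ b x z (≈-sym e) m′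

  ∈-respˡ-≈ : ∀ x y z → x ≈ₕ y → x ∈ₕ z → y ∈ₕ z
  ∈-respˡ-≈ x y (c ⊲ d) e (inj₁ m)  = inj₁ (∈-respˡ-≈ x y c e m)
  ∈-respˡ-≈ x y (c ⊲ d) e (inj₂ e′) = inj₂ (≈-trans y x d (≈-sym e) e′)

  ≈-trans : ∀ x y z → x ≈ₕ y → y ≈ₕ z → x ≈ₕ z
  ≈-trans x y z (p , p′) (q , q′) = ⊆-trans x y z p q , ⊆-trans z y x q′ p′

⊆-ext : ∀ x y → (∀ u → u ∈ₕ x → u ∈ₕ y) → x ⊆ₕ y
⊆-ext ∅       y h = tt
⊆-ext (a ⊲ b) y h = ⊆-ext a y (λ u → h u ∘ inj₁) , h b (inj₂ ≈-refl)

⊲-cong : ∀ {a b c d} → a ≈ₕ b → c ≈ₕ d → (a ⊲ c) ≈ₕ (b ⊲ d)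
⊲-cong {c = c} {d} (p , p′) (q , q′) = (⊆-weaken d p , inj₂ (q , q′)) , (⊆-weaken c p′ , inj₂ (q′ , q))

-- x ∈ₛ a: x is syntactically one of the elements a is built from, not merely ≈ to one.
infix 4 _∈ₛ_
data _∈ₛ_ : HF → HF → Set where
  last : ∀ {a b}   → b ∈ₛ (a ⊲ b)
  init : ∀ {x a b} → x ∈ₛ a → x ∈ₛ (a ⊲ b)

∈ₛ⇒∈ₕ : ∀ {x a} → x ∈ₛ a → x ∈ₕ a
∈ₛ⇒∈ₕ last     = inj₂ ≈-refl
∈ₛ⇒∈ₕ (init p) = inj₁ (∈ₛ⇒∈ₕ p)

evalT-subT : ∀ ρ σ ρ′ → (∀ n → evalT ρ (σ n) ≡ ρ′ n) → ∀ t → evalT ρ (subT σ t) ≡ evalT ρ′ t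
evalT-subT ρ σ ρ′ h (var n) = h n
evalT-subT ρ σ ρ′ h zer     = refl
evalT-subT ρ σ ρ′ h (t ◁ u) = cong₂ _⊲_ (evalT-subT ρ σ ρ′ h t) (evalT-subT ρ σ ρ′ h u)

evalT-shiftT : ∀ x ρ t → evalT (x ∷ₑ ρ) (shiftT t) ≡ evalT ρ t
evalT-shiftT x ρ (var n) = refl
evalT-shiftT x ρ zer     = refl
evalT-shiftT x ρ (t ◁ u) = cong₂ _⊲_ (evalT-shiftT x ρ t) (evalT-shiftT x ρ u)

⟦sub⟧ : ∀ A σ ρ ρ′ → (∀ n → evalT ρ (σ n) ≡ ρ′ n) → ⟦ sub σ A ⟧ ρ ⇔ ⟦ A ⟧ ρ′
⟦sub⟧ (t IN u) σ ρ ρ′ h =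
  mk⇔ (subst₂ _∈ₕ_ (evalT-subT ρ σ ρ′ h t) (evalT-subT ρ σ ρ′ h u))
      (subst₂ _∈ₕ_ (sym (evalT-subT ρ σ ρ′ h t)) (sym (evalT-subT ρ σ ρ′ h u)))
⟦sub⟧ (t EQ u) σ ρ ρ′ h =
  mk⇔ (subst₂ _≈ₕ_ (evalT-subT ρ σ ρ′ h t) (evalT-subT ρ σ ρ′ h u))
      (subst₂ _≈ₕ_ (sym (evalT-subT ρ σ ρ′ h t)) (sym (evalT-subT ρ σ ρ′ h u)))
⟦sub⟧ (A OR B) σ ρ ρ′ h =
  mk⇔ (⊎-map (to (⟦sub⟧ A σ ρ ρ′ h)) (to (⟦sub⟧ B σ ρ ρ′ h)))
      (⊎-map (from (⟦sub⟧ A σ ρ ρ′ h)) (from (⟦sub⟧ B σ ρ ρ′ h)))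
⟦sub⟧ (NEG A) σ ρ ρ′ h = mk⇔ (_∘ from (⟦sub⟧ A σ ρ ρ′ h)) (_∘ to (⟦sub⟧ A σ ρ ρ′ h))
⟦sub⟧ (EX A) σ ρ ρ′ h =
  mk⇔ (λ { (x , a) → x , to   (⟦sub⟧ A (extS σ) (x ∷ₑ ρ) (x ∷ₑ ρ′) (extS-eval x)) a })
      (λ { (x , a) → x , from (⟦sub⟧ A (extS σ) (x ∷ₑ ρ) (x ∷ₑ ρ′) (extS-eval x)) a })
  where
  extS-eval : ∀ x n → evalT (x ∷ₑ ρ) (extS σ n) ≡ (x ∷ₑ ρ′) n
  extS-eval x zero    = refl
  extS-eval x (suc n) = trans (evalT-shiftT x ρ (σ n)) (h n)

module Classical (em : ExcludedMiddle 0ℓ) where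

  private
    dne : ∀ {P : Set} → ¬ ¬ P → P
    dne = em⇒dne em

  ⇒-intro : ∀ {P Q : Set} → (P → Q) → ¬ P ⊎ Q
  ⇒-intro {P} f with em {P}
  ... | yes p = inj₂ (f p)
  ... | no ¬p = inj₁ ¬p

  ⇒-elim : ∀ {P Q : Set} → ¬ P ⊎ Q → P → Q
  ⇒-elim (inj₁ ¬p) p = ⊥-elim (¬p p)
  ⇒-elim (inj₂ q)  _ = q

  ∧-intro : ∀ {P Q : Set} → P → Q → ¬ (¬ P ⊎ ¬ Q)
  ∧-intro p q (inj₁ ¬p) = ¬p p
  ∧-intro p q (inj₂ ¬q) = ¬q q

  ∧-proj₁ : ∀ {P Q : Set} → ¬ (¬ P ⊎ ¬ Q) → P
  ∧-proj₁ h = dne (h ∘ inj₁)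

  ∧-proj₂ : ∀ {P Q : Set} → ¬ (¬ P ⊎ ¬ Q) → Q
  ∧-proj₂ h = dne (h ∘ inj₂)

  ⇔-intro : ∀ {P Q : Set} → (P → Q) → (Q → P) → ¬ (¬ (¬ P ⊎ Q) ⊎ ¬ (¬ Q ⊎ P))
  ⇔-intro f g = ∧-intro (⇒-intro f) (⇒-intro g)

  ⇔-to : ∀ {P Q : Set} → ¬ (¬ (¬ P ⊎ Q) ⊎ ¬ (¬ Q ⊎ P)) → P → Q
  ⇔-to h = ⇒-elim (∧-proj₁ h)

  ⇔-from : ∀ {P Q : Set} → ¬ (¬ (¬ P ⊎ Q) ⊎ ¬ (¬ Q ⊎ P)) → Q → P
  ⇔-from h = ⇒-elim (∧-proj₂ h)

  ∀-intro : ∀ {A : HF → Set} → (∀ x → A x) → ¬ Σ HF (λ x → ¬ A x)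
  ∀-intro f (x , ¬a) = ¬a (f x)

  ∀-elim : ∀ {A : HF → Set} → ¬ Σ HF (λ x → ¬ A x) → ∀ x → A x
  ∀-elim h x = dne (λ ¬a → h (x , ¬a))

module Soundness (em : ExcludedMiddle 0ℓ) (X : Fm) (X-closed : Sentence X) (X-true : TrueHF X) where
  open Classical em

  X-valid : ∀ ρ → ⟦ X ⟧ ρ
  X-valid ρ = subst (λ A → ⟦ A ⟧ ρ) (sentence-sub {X} X-closed (λ _ → zer))
                (from (⟦sub⟧ X (λ _ → zer) ρ (λ _ → ∅) (λ _ → refl)) X-true)

  BoolAx-valid : ∀ {A} → BoolAx A → ∀ ρ → ⟦ A ⟧ ρ
  BoolAx-valid (ident A)         ρ = ⇒-intro (λ a → a)
  BoolAx-valid (disjI1 A B)      ρ = ⇒-intro inj₁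
  BoolAx-valid (disjCont A)      ρ = ⇒-intro λ { (inj₁ a) → a ; (inj₂ a) → a }
  BoolAx-valid (disjAssoc A B C) ρ =
    ⇒-intro λ { (inj₁ a) → inj₁ (inj₁ a) ; (inj₂ (inj₁ b)) → inj₁ (inj₂ b) ; (inj₂ (inj₂ c)) → inj₂ c }
  BoolAx-valid (disjConj A B C)  ρ = ⇒-intro λ ca → ⇒-intro (resolve ca)
    where
    resolve : ⟦ C OR A ⟧ ρ → ⟦ NEG C OR B ⟧ ρ → ⟦ A OR B ⟧ ρ
    resolve (inj₁ c) (inj₁ ¬c) = ⊥-elim (¬c c)
    resolve (inj₁ c) (inj₂ b)  = inj₂ b
    resolve (inj₂ a) _         = inj₁ a

  EqAx-valid : ∀ {A} → EqAx A → ∀ ρ → ⟦ A ⟧ ρ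
  EqAx-valid eqRefl ρ = ≈-refl
  EqAx-valid eqIn ρ = ⇒-intro λ h → ⇒-intro λ m →
    ∈-resp-⊆ (ρ 1) (ρ 2) (ρ 3) (∈-respˡ-≈ (ρ 0) (ρ 1) (ρ 2) (∧-proj₁ h) m) (proj₁ (∧-proj₂ h))
  EqAx-valid eqEq ρ = ⇒-intro λ h → ⇒-intro λ e →
    ≈-trans (ρ 1) (ρ 2) (ρ 3) (≈-trans (ρ 1) (ρ 0) (ρ 2) (≈-sym (∧-proj₁ h)) e) (∧-proj₂ h)
  EqAx-valid eqEats ρ = ⇒-intro λ h → ⊲-cong (∧-proj₁ h) (∧-proj₂ h)

  HFAx-valid : ∀ {A} → HFAx A → ∀ ρ → ⟦ A ⟧ ρ
  HFAx-valid hf1 ρ =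
    ⇔-intro (λ e → ∀-intro λ u m → ∈-resp-⊆ u (ρ 0) ∅ m (proj₁ e))
            (λ h → ⊆-ext (ρ 0) ∅ (λ u p → ⊥-elim (∀-elim h u p)) , tt)
  HFAx-valid hf2 ρ =
    ⇔-intro (λ e → ∀-intro λ u → ⇔-intro (λ m → ∈-resp-⊆ u (ρ 0) (ρ 1 ⊲ ρ 2) m (proj₁ e))
                                          (λ m → ∈-resp-⊆ u (ρ 1 ⊲ ρ 2) (ρ 0) m (proj₂ e)))
            (λ h → ⊆-ext (ρ 0) (ρ 1 ⊲ ρ 2) (λ u → ⇔-to (∀-elim h u)) ,
                   ⊆-ext (ρ 1 ⊲ ρ 2) (ρ 0) (λ u → ⇔-from (∀-elim h u)))

  IndAx-valid : ∀ {A} → IndAx A → ∀ ρ → ⟦ A ⟧ ρ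
  IndAx-valid (ind φ) ρ = ⇒-intro λ h → ∀-intro (induction h)
    where
    induction : ⟦ (φ [ zer ]) AND ALL (ALL ((sub σx φ AND sub σy φ) IMP sub σxy φ)) ⟧ ρ →
                ∀ x → ⟦ φ ⟧ (x ∷ₑ ρ)
    induction h ∅ = to (⟦sub⟧ φ (sub0 zer) ρ (∅ ∷ₑ ρ) (λ { zero → refl ; (suc n) → refl })) (∧-proj₁ h)
    induction h (x ⊲ y) =
      to (⟦sub⟧ φ σxy (y ∷ₑ (x ∷ₑ ρ)) ((x ⊲ y) ∷ₑ ρ) (λ { zero → refl ; (suc n) → refl }))
        (⇒-elim (∀-elim (∀-elim (∧-proj₂ h) x) y)
          (∧-intro (from (⟦sub⟧ φ σx (y ∷ₑ (x ∷ₑ ρ)) (x ∷ₑ ρ) (λ { zero → refl ; (suc n) → refl })) (induction h x))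
                   (from (⟦sub⟧ φ σy (y ∷ₑ (x ∷ₑ ρ)) (y ∷ₑ ρ) (λ { zero → refl ; (suc n) → refl })) (induction h y))))

  sound′ : ∀ {H A} → Deriv X H A → H ≡ [] → ∀ ρ → ⟦ A ⟧ ρ
  sound′ (hyp ()) refl
  sound′ extra     _ = X-valid
  sound′ (bool ax) _ = BoolAx-valid ax
  sound′ (eq ax)   _ = EqAx-valid ax
  sound′ (hf ax)   _ = HFAx-valid ax
  sound′ (induc ax) _ = IndAx-valid ax
  sound′ (quant (exI A t)) _ ρ =
    ⇒-intro λ a → evalT ρ t , to (⟦sub⟧ A (sub0 t) ρ (evalT ρ t ∷ₑ ρ) (λ { zero → refl ; (suc n) → refl })) a
  sound′ (mp {H = H} {H′} d e) H++H′≡[] ρ =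
    ⇒-elim (sound′ d (++-conicalˡ H H′ H++H′≡[]) ρ) (sound′ e (++-conicalʳ H H′ H++H′≡[]) ρ)
  sound′ (exR {A = A} {B} d) refl ρ = ⇒-intro λ { (x , a) → unshift x (⇒-elim (sound′ d refl (x ∷ₑ ρ)) a) }
    where
    unshift : ∀ x → ⟦ shift B ⟧ (x ∷ₑ ρ) → ⟦ B ⟧ ρ
    unshift x b = to (⟦sub⟧ B (var ∘ suc) (x ∷ₑ ρ) ρ (λ _ → refl)) (subst (λ C → ⟦ C ⟧ (x ∷ₑ ρ)) (ren-as-sub suc B) b)

  sound : ∀ {A} → Deriv X [] A → ∀ ρ → ⟦ A ⟧ ρ
  sound d = sound′ d refl

⌜_⌝ : HF → Tm
⌜ ∅ ⌝     = zer
⌜ a ⊲ b ⌝ = ⌜ a ⌝ ◁ ⌜ b ⌝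

module Σ-Completeness (em : ExcludedMiddle 0ℓ) (X : Fm) (X-closed : Sentence X) where
  open FirstOrder X X-closed
  open Classical em

  ⊲-members : Tm → Tm → Tm → Fm
  ⊲-members z t s = (v0 IN shiftT z) IFF ((v0 IN shiftT t) OR (v0 EQ shiftT s))

  EQ-◁-iff : ∀ z t s → ⊢ ((z EQ (t ◁ s)) IFF ALL (⊲-members z t s))
  EQ-◁-iff z t s = HFAx-sub hf2 ((z ∷ t ∷ s ∷ zer ∷ []) ++ₛ var)

  ◁-members : ∀ t s → ⊢ ⊲-members (t ◁ s) t s
  ◁-members t s =
    ALL-elim (taut ((a₀ ⇔ₚ a₁) ⇒ₚ a₀ ⇒ₚ a₁) ((t ◁ s) EQ (t ◁ s) ∷ ALL (⊲-members (t ◁ s) t s) ∷ [])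
                · EQ-◁-iff (t ◁ s) t s · EQ-refl (t ◁ s))

  IN-◁ : ∀ t s u → ⊢ ((u IN (t ◁ s)) IFF ((u IN t) OR (u EQ s)))
  IN-◁ t s u = subst₂ (λ t′ s′ → ⊢ ((u IN (t′ ◁ s′)) IFF ((u IN t′) OR (u EQ s′))))
                 (subT-sub0-shiftT u t) (subT-sub0-shiftT u s) (ALL-inst (ALL-intro (◁-members t s)) u)

  NOT-IN-zer : ⊢ ALL (NEG (v0 IN zer))
  NOT-IN-zer = taut ((a₀ ⇔ₚ a₁) ⇒ₚ a₀ ⇒ₚ a₁) ((zer EQ zer) ∷ ALL (NEG (v0 IN zer)) ∷ [])
                 · HFAx-sub hf1 (λ _ → zer) · EQ-refl zer

  -- Recursion along the numeral: HF2 splits v ∈ t ◁ s into v ∈ t and v = s, and the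
  -- case v = s is handled by equality substitution.
  ALL2-numeral : ∀ Q a → (∀ x → x ∈ₛ a → ⊢ Q [ ⌜ x ⌝ ]) → ⊢ ALL2 ⌜ a ⌝ Q
  ALL2-numeral Q ∅ _ = ALL-map NOT-IN-zer (taut ((¬ₚ a₀) ⇒ₚ (a₀ ⇒ₚ a₁)) ((v0 IN zer) ∷ Q ∷ []))
  ALL2-numeral Q (a ⊲ b) h =
    ALL-intro (taut ((a₀ ⇔ₚ (a₁ ∨ₚ a₂)) ⇒ₚ (a₁ ⇒ₚ a₃) ⇒ₚ (a₂ ⇒ₚ a₃) ⇒ₚ (a₀ ⇒ₚ a₃))
                    ((v0 IN shiftT (t ◁ s)) ∷ (v0 IN shiftT t) ∷ E ∷ Q ∷ [])
                 · ◁-members t s · ALL-elim (ALL2-numeral Q a (λ x → h x ∘ init)) · E⇒Q)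
    where
    t s : Tm
    t = ⌜ a ⌝
    s = ⌜ b ⌝
    E : Fm
    E = v0 EQ shiftT s
    τ : Subst
    τ = shiftT ∘ sub0 s
    E⇒τ≈var : ∀ n → ⊢ (E IMP (τ n EQ var n))
    E⇒τ≈var zero    = EQ-sym v0 (shiftT s)
    E⇒τ≈var (suc m) = taut (a₁ ⇒ₚ (a₀ ⇒ₚ a₁)) (E ∷ (var (suc m) EQ var (suc m)) ∷ []) · EQ-refl (var (suc m))
    Q[τ] : ⊢ sub τ Q
    Q[τ] = subst ⊢_ (ren-sub suc (sub0 s) Q) (⊢-shift (h b last))
    E⇒Q : ⊢ (E IMP Q)
    E⇒Q = subst (λ C → ⊢ (E IMP C)) (sub-var Q)
            (taut ((a₀ ⇒ₚ a₁ ⇒ₚ a₂) ⇒ₚ a₁ ⇒ₚ (a₀ ⇒ₚ a₂)) (E ∷ sub τ Q ∷ sub var Q ∷ [])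
               · EQ-sub Q E τ var E⇒τ≈var · Q[τ])

  IN-◁-intro : ∀ {t s u} → ⊢ ((u IN t) OR (u EQ s)) → ⊢ (u IN (t ◁ s))
  IN-◁-intro {t} {s} {u} d =
    taut ((a₀ ⇔ₚ a₁) ⇒ₚ a₁ ⇒ₚ a₀) ((u IN (t ◁ s)) ∷ ((u IN t) OR (u EQ s)) ∷ []) · IN-◁ t s u · d

  mutual
    numeral-∈ : ∀ a b → a ∈ₕ b → ⊢ (⌜ a ⌝ IN ⌜ b ⌝)
    numeral-∈ a (b₁ ⊲ b₂) (inj₁ a∈b₁) = IN-◁-intro (∨-introˡ (numeral-∈ a b₁ a∈b₁))
    numeral-∈ a (b₁ ⊲ b₂) (inj₂ a≈b₂) = IN-◁-intro (∨-introʳ (numeral-≈ a b₂ a≈b₂))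

    numeral-≈ : ∀ a b → a ≈ₕ b → ⊢ (⌜ a ⌝ EQ ⌜ b ⌝)
    numeral-≈ ∅       ∅ _              = EQ-refl zer
    numeral-≈ (_ ⊲ _) ∅ ((_ , ()) , _)
    numeral-≈ a b@(b₁ ⊲ b₂) (a⊆b , b⊆a) =
      taut ((a₀ ⇔ₚ a₁) ⇒ₚ a₁ ⇒ₚ a₀) ((⌜ a ⌝ EQ ⌜ b ⌝) ∷ ALL (⊲-members ⌜ a ⌝ t s) ∷ [])
        · EQ-◁-iff ⌜ a ⌝ t s
        · ALL-intro (taut ((a₀ ⇔ₚ a₁) ⇒ₚ (a₂ ⇒ₚ a₀) ⇒ₚ (a₀ ⇒ₚ a₂) ⇒ₚ (a₂ ⇔ₚ a₁))
                          ((v0 IN shiftT ⌜ b ⌝) ∷ ((v0 IN shiftT t) OR (v0 EQ shiftT s)) ∷ (v0 IN shiftT ⌜ a ⌝) ∷ [])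
                       · ◁-members t s
                       · ALL-elim (numeral-⊆ a b a⊆b)
                       · ALL-elim (numeral-⊆ b a b⊆a))
      where
      t s : Tm
      t = ⌜ b₁ ⌝
      s = ⌜ b₂ ⌝

    numeral-⊆ : ∀ a b → a ⊆ₕ b → ⊢ ALL2 ⌜ a ⌝ (v0 IN shiftT ⌜ b ⌝)
    numeral-⊆ a b a⊆b = ALL2-numeral (v0 IN shiftT ⌜ b ⌝) a (numeral-⊆-elements a b a⊆b)

    numeral-⊆-elements : ∀ a b → a ⊆ₕ b → ∀ x → x ∈ₛ a → ⊢ (v0 IN shiftT ⌜ b ⌝) [ ⌜ x ⌝ ]
    numeral-⊆-elements (_ ⊲ x) b (_ , x∈b) _ last =
      subst (λ u → ⊢ (⌜ x ⌝ IN u)) (sym (subT-sub0-shiftT ⌜ x ⌝ ⌜ b ⌝)) (numeral-∈ x b x∈b)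
    numeral-⊆-elements (a ⊲ _) b (a⊆b , _) x (init x∈a) = numeral-⊆-elements a b a⊆b x x∈a

  sub-numerals-∷ₑ : ∀ x ρ A → sub (⌜_⌝ ∘ (x ∷ₑ ρ)) A ≡ sub (extS (⌜_⌝ ∘ ρ)) A [ ⌜ x ⌝ ]
  sub-numerals-∷ₑ x ρ A =
    trans (sub-ext (λ { zero → refl ; (suc n) → refl }) A) (sym ([]-as-sub (⌜_⌝ ∘ ρ) ⌜ x ⌝ A))

  strictΣ-complete : ∀ {B} → StrictΣ B → ∀ ρ → ⟦ B ⟧ ρ → ⊢ sub (⌜_⌝ ∘ ρ) B
  strictΣ-complete (sIn i j) ρ i∈j = numeral-∈ (ρ i) (ρ j) i∈j
  strictΣ-complete (sOr sA sB) ρ (inj₁ a) = ∨-introˡ (strictΣ-complete sA ρ a)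
  strictΣ-complete (sOr sA sB) ρ (inj₂ b) = ∨-introʳ (strictΣ-complete sB ρ b)
  strictΣ-complete (sAnd {A} {B} sA sB) ρ ab =
    taut (a₀ ⇒ₚ a₁ ⇒ₚ (a₀ ∧ₚ a₁)) (sub (⌜_⌝ ∘ ρ) A ∷ sub (⌜_⌝ ∘ ρ) B ∷ [])
      · strictΣ-complete sA ρ (∧-proj₁ ab) · strictΣ-complete sB ρ (∧-proj₂ ab)
  strictΣ-complete (sEx {A} sA) ρ (x , a) =
    EX-intro ⌜ x ⌝ (subst ⊢_ (sub-numerals-∷ₑ x ρ A) (strictΣ-complete sA (x ∷ₑ ρ) a))
  strictΣ-complete (sAll {A} j sA _) ρ h =
    ALL2-numeral (sub (extS (⌜_⌝ ∘ ρ)) A) (ρ j) λ x x∈ρj →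
      subst ⊢_ (sub-numerals-∷ₑ x ρ A) (strictΣ-complete sA (x ∷ₑ ρ) (⇒-elim (∀-elim h x) (∈ₛ⇒∈ₕ x∈ρj)))

mainTheorem2 : ExcludedMiddle 0ℓ →
               (X : Fm) → Sentence X → TrueHF X →
               (A : Fm) → IsΣ X A → Sentence A → TrueHF A →
               Deriv X [] A
mainTheorem2 em X X-closed X-true A (B , B-strict , free-B⇒free-A , A⇔B) A-closed A-true =
  taut ((a₀ ⇔ₚ a₁) ⇒ₚ a₁ ⇒ₚ a₀) (A ∷ B ∷ []) · A⇔B · ⊢B
  where
  open FirstOrder X X-closed
  open Classical em using (⇔-to)
  open Soundness em X X-closed X-true using (sound)
  open Σ-Completeness em X X-closed using (strictΣ-complete)

  B-closed : Sentence B
  B-closed n = A-closed n ∘ free-B⇒free-A n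

  B-true : TrueHF B
  B-true = ⇔-to (sound A⇔B (λ _ → ∅)) A-true

  ⊢B : ⊢ B
  ⊢B = subst ⊢_ (sentence-sub B-closed (λ _ → zer)) (strictΣ-complete B-strict (λ _ → ∅) B-true)
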